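{- Let $m$, $n$, and $\ell$ be positive integers. If $m< n<2^{\ell}(m+1)$, then $\operatorname{aw}([n],3)\leq\operatorname{aw}([m],3)+\ell$.
   Context: $[m]=\{1,\dots,m\}$. A $3$-AP in a set $S$ of integers is a set of three distinct elements $a,a+d,a+2d$ of $S$ with $d\ge1$. An $r$-coloring is a map $S\to\{1,\dots,r\}$, exact if surjective; a $3$-AP is rainbow if its elements receive distinct colors. $\operatorname{aw}(S,3)$ is the smallest $r$ such that every exact $r$-coloring of $S$ contains a rainbow $3$-AP (with $\operatorname{aw}(S,3)=|S|+1$ if $|S|<3$). -}

module Defs where

open import Data.Nat using (ℕ; _+_; _*_; _<_; _≤_; _≥_)
open import Data.Fin using (Fin; toℕ)
open import Data.Product using (Σ; ∃; _×_)
open import Relation.Binary.PropositionalEquality using (_≡_; _≢_)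
open import Relation.Nullary using (¬_)

-- The interval [m] = {1,…,m} is represented by Fin m, element i ↦ toℕ i + 1
-- (a translation, which preserves 3-APs).  Colors {1,…,r} are Fin r.

Coloring : ℕ → ℕ → Set
Coloring m r = Fin m → Fin r

Exact : ∀ {m r} → Coloring m r → Set
Exact {m} {r} c = ∀ (j : Fin r) → ∃ λ (i : Fin m) → c i ≡ j

Is3AP : ∀ {m} → Fin m → Fin m → Fin m → Set
Is3AP x y z = ∃ λ (d : ℕ) → (1 ≤ d) × (toℕ y ≡ toℕ x + d) × (toℕ z ≡ toℕ x + 2 * d)

HasRainbow3AP : ∀ {m r} → Coloring m r → Set
HasRainbow3AP {m} c = ∃ λ (x : Fin m) → ∃ λ (y : Fin m) → ∃ λ (z : Fin m) →
  Is3AP x y z × (c x ≢ c y) × (c x ≢ c z) × (c y ≢ c z)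

AllExactRainbow : ℕ → ℕ → Set
AllExactRainbow m r = ∀ (c : Coloring m r) → Exact c → HasRainbow3AP c

IsAw : ℕ → ℕ → Set
IsAw m k = (m < 3 → k ≡ m + 1)
         × (3 ≤ m → 1 ≤ k × AllExactRainbow m k
                    × (∀ r → 1 ≤ r → r < k → ¬ AllExactRainbow m r))

module Submission where

-- The heart of the proof is the one-step extension lemma: if m < n ≤ 2m + 1
-- and every exact k-coloring of [m] (k ≥ 1) has a rainbow 3-AP, then so does
-- every exact (k+1)-coloring c of [n].  Call a color "seen" if it occurs on
-- the prefix [m].  If at most one color b is unseen, collapsing b onto a
-- neighbouring color turns c restricted to [m] into an exact k-coloring,
-- whose rainbow 3-AP is rainbow for c as well.  Otherwise let y be the
-- least point with an unseen color and z a point with another unseen color;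
-- minimality forces y < z, and z < n ≤ 2m + 1 ≤ 2y + 1 lets us reflect z
-- through y to a point x = 2y - z < y, whose color is seen: (x, y, z) is a
-- rainbow 3-AP.  Iterating the lemma along n, ⌊n/2⌋, ⌊n/4⌋, … adds at most
-- ℓ colors between [m] and [n]; the theorem then follows by unfolding the
-- definition of aw (with pigeonhole for the degenerate case m < 3).

open import Defs
open import Data.Nat using (ℕ; zero; suc; _+_; _*_; _^_; _∸_; _<_; _≤_; z≤n; s≤s; s≤s⁻¹; ⌊_/2⌋; _<?_; _≤?_)
open import Data.Nat.Properties hiding (_≟_)
open import Data.Fin using (Fin; toℕ; fromℕ<; inject≤; punchIn; pinch; _≟_)
  renaming (zero to fzero; suc to fsuc)
open import Data.Fin.Properties
  using (toℕ-injective; toℕ-fromℕ<; toℕ-inject≤; toℕ-inject; toℕ<n; punchInᵢ≢i; any?; all?; ¬∀⟶∃¬; ¬∀⟶∃¬-smallest; pigeonhole)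
open import Data.Product using (∃; _×_; _,_; proj₁; proj₂)
open import Data.Sum using (_⊎_; inj₁; inj₂)
open import Data.Empty using (⊥-elim)
open import Relation.Nullary using (¬_; Dec; yes; no)
open import Relation.Nullary.Decidable using (_⊎-dec_)
open import Relation.Binary.PropositionalEquality
open import Relation.Binary.Definitions using (tri<; tri≈; tri>)

first-failure : ∀ {n} (P : Fin n → Set) → (∀ p → Dec (P p)) →
                (∀ p → P p) ⊎ ∃ λ y → ¬ P y × (∀ p → toℕ p < toℕ y → P p)
first-failure {n} P P? with all? P?
... | yes all-P = inj₁ all-P
... | no ¬all-P with ¬∀⟶∃¬-smallest n P P? ¬all-P
... | y , ¬Py , below = inj₂ (y , ¬Py , below′)
  where
  below′ : ∀ p → toℕ p < toℕ y → P p
  below′ p p<y = subst P (toℕ-injective (trans (toℕ-inject q) (toℕ-fromℕ< p<y))) (below q)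
    where q = fromℕ< p<y

rainbow-uncollapse : ∀ {m r s} (c : Coloring m r) (φ : Fin r → Fin s) →
                     HasRainbow3AP (λ i → φ (c i)) → HasRainbow3AP c
rainbow-uncollapse c φ (x , y , z , ap , φxy , φxz , φyz) =
  x , y , z , ap , (λ e → φxy (cong φ e)) , (λ e → φxz (cong φ e)) , (λ e → φyz (cong φ e))

rainbow-extend : ∀ {m n r} (m≤n : m ≤ n) (c : Coloring n r) →
                 HasRainbow3AP (λ i → c (inject≤ i m≤n)) → HasRainbow3AP c
rainbow-extend m≤n c (x , y , z , (d , d≥1 , y≡ , z≡) , cxy , cxz , cyz) =
  ι x , ι y , ι z , (d , d≥1 , shift y x y≡ , shift z x z≡) , cxy , cxz , cyz
  where
  ι = λ i → inject≤ i m≤n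
  shift : ∀ i j {t} → toℕ i ≡ toℕ j + t → toℕ (ι i) ≡ toℕ (ι j) + t
  shift i j {t} e = begin
    toℕ (ι i)     ≡⟨ toℕ-inject≤ i m≤n ⟩
    toℕ i         ≡⟨ e ⟩
    toℕ j + t     ≡⟨ cong (_+ t) (sym (toℕ-inject≤ j m≤n)) ⟩
    toℕ (ι j) + t ∎
    where open ≡-Reasoning

-- squash b : Fin (k+2) → Fin (k+1) merges the color b with a neighbour; it
-- is a left inverse of punchIn b, so it stays surjective when b is dropped.
squash : ∀ {k} → Fin (suc (suc k)) → Fin (suc (suc k)) → Fin (suc k)
squash fzero    = pinch fzero
squash (fsuc i) = pinch i

pinch-punchIn : ∀ {k} (i j : Fin k) → pinch i (punchIn (fsuc i) j) ≡ j
pinch-punchIn i        fzero    = refl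
pinch-punchIn fzero    (fsuc j) = refl
pinch-punchIn (fsuc i) (fsuc j) = cong fsuc (pinch-punchIn i j)

squash-punchIn : ∀ {k} (b : Fin (suc (suc k))) (j : Fin (suc k)) → squash b (punchIn b j) ≡ j
squash-punchIn fzero    j = refl
squash-punchIn (fsuc i) j = pinch-punchIn i j

-- If all colors but (possibly) b occur on the prefix [m], the rainbow
-- property for k colors on [m] yields one for k+1 colors on [n]
-- (k ≥ 1 is needed for squash; the 3-AP lies inside [m]).
rainbow-one-unseen : ∀ {m n k} (m≤n : m ≤ n) → 1 ≤ k → AllExactRainbow m k →
                     (c : Coloring n (suc k)) (b : Fin (suc k)) →
                     (∀ j → j ≡ b ⊎ ∃ λ i → c (inject≤ i m≤n) ≡ j) → HasRainbow3AP c
rainbow-one-unseen m≤n (s≤s z≤n) all-m c b seen =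
  rainbow-extend m≤n c (rainbow-uncollapse (λ i → c (inject≤ i m≤n)) (squash b) (all-m g g-exact))
  where
  g = λ i → squash b (c (inject≤ i m≤n))
  g-exact : Exact g
  g-exact j with seen (punchIn b j)
  ... | inj₁ eq      = ⊥-elim (punchInᵢ≢i b j eq)
  ... | inj₂ (i , e) = i , trans (cong (squash b) e) (squash-punchIn b j)

reflect : ∀ {y z} → y < z → z ≤ y + y → ∃ λ x → ∃ λ d → 1 ≤ d × y ≡ x + d × z ≡ x + 2 * d
reflect {y} {z} y<z z≤2y = y ∸ d , d , m<n⇒0<n∸m y<z , sym (m∸n+n≡m d≤y) , z≡
  where
  d = z ∸ y
  d≤y : d ≤ y
  d≤y = ≤-trans (∸-monoˡ-≤ y z≤2y) (≤-reflexive (m+n∸m≡n y y))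
  z≡ : z ≡ (y ∸ d) + 2 * d
  z≡ = begin
    z                     ≡⟨ sym (m+[n∸m]≡n (<⇒≤ y<z)) ⟩
    y + d                 ≡⟨ cong (_+ d) (sym (m∸n+n≡m d≤y)) ⟩
    (y ∸ d) + d + d       ≡⟨ +-assoc (y ∸ d) d d ⟩
    (y ∸ d) + (d + d)     ≡⟨ cong (λ t → (y ∸ d) + (d + t)) (sym (+-identityʳ d)) ⟩
    (y ∸ d) + 2 * d       ∎
    where open ≡-Reasoning

reflect-in : ∀ {n} (y z : Fin n) → toℕ y < toℕ z → toℕ z ≤ toℕ y + toℕ y →
             ∃ λ x → toℕ x < toℕ y × Is3AP x y z
reflect-in y z y<z z≤2y with reflect y<z z≤2y
... | x , d , d≥1 , y≡ , z≡ = fromℕ< x<n , subst (_< toℕ y) (sym x≡) x<y ,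
      d , d≥1 , trans y≡ (cong (_+ d) (sym x≡)) , trans z≡ (cong (_+ 2 * d) (sym x≡))
  where
  x<y : x < toℕ y
  x<y = subst (x <_) (sym y≡) (m<m+n x d≥1)
  x<n = <-trans x<y (toℕ<n y)
  x≡  = toℕ-fromℕ< x<n

module ExtendStep {m n k} (k≥1 : 1 ≤ k) (m<n : m < n) (n≤2m+1 : n ≤ suc (m + m))
                  (all-m : AllExactRainbow m k)
                  (c : Coloring n (suc k)) (c-exact : Exact c) where

  m≤n : m ≤ n
  m≤n = <⇒≤ m<n

  Seen : Fin (suc k) → Set
  Seen j = ∃ λ i → c (inject≤ i m≤n) ≡ j

  seen? : ∀ j → Dec (Seen j)
  seen? j = any? (λ i → c (inject≤ i m≤n) ≟ j)

  seen-prefix : ∀ p → toℕ p < m → Seen (c p)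
  seen-prefix p p<m = fromℕ< p<m , cong c (toℕ-injective (trans (toℕ-inject≤ _ m≤n) (toℕ-fromℕ< p<m)))

  two-unseen : (y : Fin n) → ¬ Seen (c y) → (∀ p → toℕ p < toℕ y → Seen (c p)) →
               (z : Fin n) → c z ≢ c y → ¬ Seen (c z) → HasRainbow3AP c
  two-unseen y y-unseen below-y z cz≢cy z-unseen with reflect-in y z y<z z≤2y
    where
    y<z : toℕ y < toℕ z
    y<z with <-cmp (toℕ y) (toℕ z)
    ... | tri< lt _ _ = lt
    ... | tri≈ _ eq _ = ⊥-elim (cz≢cy (cong c (toℕ-injective (sym eq))))
    ... | tri> _ _ gt = ⊥-elim (z-unseen (below-y z gt))
    m≤y : m ≤ toℕ y
    m≤y = ≮⇒≥ λ y<m → y-unseen (seen-prefix y y<m)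
    z≤2y : toℕ z ≤ toℕ y + toℕ y
    z≤2y = ≤-trans (s≤s⁻¹ (≤-trans (toℕ<n z) n≤2m+1)) (+-mono-≤ m≤y m≤y)
  ... | x , x<y , ap = x , y , z , ap , cx≢cy , cx≢cz , (λ e → cz≢cy (sym e))
    where
    cx≢cy : c x ≢ c y
    cx≢cy e = y-unseen (subst Seen e (below-y x x<y))
    cx≢cz : c x ≢ c z
    cx≢cz e = z-unseen (subst Seen e (below-y x x<y))

  least-unseen : (y : Fin n) → ¬ Seen (c y) → (∀ p → toℕ p < toℕ y → Seen (c p)) →
                 HasRainbow3AP c
  least-unseen y y-unseen below-y with all? (λ j → (j ≟ c y) ⊎-dec seen? j)
  ... | yes one-unseen = rainbow-one-unseen m≤n k≥1 all-m c (c y) one-unseen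
  ... | no ¬one-unseen with ¬∀⟶∃¬ (suc k) _ (λ j → (j ≟ c y) ⊎-dec seen? j) ¬one-unseen
  ... | b , b-new with c-exact b
  ... | z , refl = two-unseen y y-unseen below-y z (λ e → b-new (inj₁ e)) (λ s → b-new (inj₂ s))

  rainbow : HasRainbow3AP c
  rainbow with first-failure (λ p → Seen (c p)) (λ p → seen? (c p))
  ... | inj₁ all-seen = rainbow-one-unseen m≤n k≥1 all-m c fzero
          (λ j → inj₂ (all-seen-colors j))
    where
    all-seen-colors : ∀ j → Seen j
    all-seen-colors j with c-exact j
    ... | p , refl = all-seen p
  ... | inj₂ (y , y-unseen , below-y) = least-unseen y y-unseen below-y

extend-step : ∀ {m n k} → 1 ≤ k → m < n → n ≤ suc (m + m) →
              AllExactRainbow m k → AllExactRainbow n (suc k)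
extend-step k≥1 m<n n≤2m+1 all-m c c-exact = ExtendStep.rainbow k≥1 m<n n≤2m+1 all-m c c-exact

half-lower : ∀ n → ⌊ n /2⌋ + ⌊ n /2⌋ ≤ n
half-lower n = ≤-trans (+-monoʳ-≤ ⌊ n /2⌋ (⌊n/2⌋≤⌈n/2⌉ n)) (≤-reflexive (⌊n/2⌋+⌈n/2⌉≡n n))

half-upper : ∀ n → n ≤ suc (⌊ n /2⌋ + ⌊ n /2⌋)
half-upper zero          = z≤n
half-upper (suc zero)    = s≤s z≤n
half-upper (suc (suc n)) =
  s≤s (≤-trans (s≤s (half-upper n)) (≤-reflexive (cong suc (sym (+-suc h h)))))
  where h = ⌊ n /2⌋

half-above : ∀ {m n} → ¬ n ≤ suc (m + m) → m < ⌊ n /2⌋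
half-above {m} {n} n≰2m+1 =
  ≰⇒> λ h≤m → n≰2m+1 (≤-trans (half-upper n) (s≤s (+-mono-≤ h≤m h≤m)))

extend-chain : ∀ ℓ {m n k} → 1 ≤ k → m < n → n < 2 ^ ℓ * (m + 1) →
               AllExactRainbow m k → ∃ λ j → j ≤ ℓ × AllExactRainbow n (k + j)
extend-chain zero {m} {n} _ m<n n<m+1 _ =
  ⊥-elim (<⇒≱ m<n (s≤s⁻¹ (subst (n <_) (trans (*-identityˡ (m + 1)) (+-comm m 1)) n<m+1)))
extend-chain (suc ℓ) {m} {n} {k} k≥1 m<n n<2A all-m with n ≤? suc (m + m)
... | yes n≤2m+1 = 1 , s≤s z≤n , subst (AllExactRainbow n) (+-comm 1 k) (extend-step k≥1 m<n n≤2m+1 all-m)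
... | no n≰2m+1 with extend-chain ℓ k≥1 (half-above n≰2m+1) h<A all-m
  where
  h = ⌊ n /2⌋
  A = 2 ^ ℓ * (m + 1)
  h<A : h < A
  h<A = ≰⇒> λ A≤h → <⇒≱ n<2A (begin
    2 ^ suc ℓ * (m + 1) ≡⟨ *-assoc 2 (2 ^ ℓ) (m + 1) ⟩
    A + (A + 0)         ≡⟨ cong (A +_) (+-identityʳ A) ⟩
    A + A               ≤⟨ +-mono-≤ A≤h A≤h ⟩
    h + h               ≤⟨ half-lower n ⟩
    n                   ∎)
    where open ≤-Reasoning
... | j , j≤ℓ , all-h = suc j , s≤s j≤ℓ ,
  subst (AllExactRainbow n) (sym (+-suc k j))
        (extend-step (≤-trans k≥1 (m≤m+n k j)) h<n (half-upper n) all-h)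
  where
  h = ⌊ n /2⌋
  h<n : h < n
  h<n = <-≤-trans (m<m+n h (≤-<-trans (z≤n {m}) (half-above n≰2m+1))) (half-lower n)

no-exact-coloring : ∀ {m r} → m < r → (c : Coloring m r) → ¬ Exact c
no-exact-coloring m<r c c-exact with pigeonhole m<r (λ j → proj₁ (c-exact j))
... | i , j , i<j , same-preimage = <-irrefl (cong toℕ i≡j) i<j
  where
  i≡j = trans (sym (proj₂ (c-exact i))) (trans (cong c same-preimage) (proj₂ (c-exact j)))

-- aw([m],3) colors always force a rainbow 3-AP (vacuously when m < 3) ...
aw-forces : ∀ {m a} → IsAw m a → 1 ≤ a × AllExactRainbow m a
aw-forces {m} (small , large) with m <? 3
... | yes m<3 rewrite small m<3 =
  m≤n+m 1 m , λ c c-exact → ⊥-elim (no-exact-coloring (m<m+n m (s≤s z≤n)) c c-exact)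
... | no m≮3 with large (≮⇒≥ m≮3)
... | a≥1 , all-a , _ = a≥1 , all-a

aw-least : ∀ {n a r} → 3 ≤ n → IsAw n a → 1 ≤ r → AllExactRainbow n r → a ≤ r
aw-least n≥3 (_ , large) r≥1 all-r with large n≥3
... | _ , _ , minimal = ≮⇒≥ λ r<a → minimal _ r≥1 r<a all-r

proposition2p19 : ∀ (m n ℓ : ℕ) → 1 ≤ m → 1 ≤ n → 1 ≤ ℓ →
    m < n → n < 2 ^ ℓ * (m + 1) →
    ∀ (awn awm : ℕ) → IsAw n awn → IsAw m awm → awn ≤ awm + ℓ
proposition2p19 m n ℓ m≥1 _ ℓ≥1 m<n n<2^ℓ[m+1] awn awm aw-n aw-m with n <? 3
... | yes n<3 rewrite proj₁ aw-n n<3 | proj₁ aw-m (<-trans m<n n<3) =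
  -- degenerate case: aw([n],3) = n + 1 ≤ m + 2 ≤ aw([m],3) + ℓ
  ≤-trans (+-monoˡ-≤ 1 (≤-trans (s≤s⁻¹ n<3) (+-monoˡ-≤ 1 m≥1))) (+-monoʳ-≤ (m + 1) ℓ≥1)
... | no n≮3 with aw-forces aw-m
... | awm≥1 , all-m with extend-chain ℓ awm≥1 m<n n<2^ℓ[m+1] all-m
... | j , j≤ℓ , all-n =
  ≤-trans (aw-least (≮⇒≥ n≮3) aw-n (≤-trans awm≥1 (m≤m+n awm j)) all-n) (+-monoʳ-≤ awm j≤ℓ)
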